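{- Let $\mathbf{A}\in\mathbb{RL}^B$ and let $a\in A$ be Boolean. Then $[a,1]=\{x\in A: a\le x\le 1\}$ is an $\mathbb{RL}^B$-filter of $\mathbf{A}$.
   Context: A residuated lattice is an algebra $(A;\wedge,\vee,\cdot,\to,0,1)$ with $(A;\wedge,\vee,0,1)$ a bounded lattice ($0$ least, $1$ greatest), $(A;\cdot,1)$ a commutative monoid, and $a\cdot b\le c$ iff $a\le b\to c$; $\neg a=a\to0$. An element $a$ is Boolean iff $a\vee\neg a=1$. $\mathbb{RL}^B$ is the class of residuated lattices expanded with a unary operation $B$ such that $Ba\le a$, $Ba\vee\neg Ba=1$, and $b\le Ba$ whenever $b\le a$ and $b\vee\neg b=1$. An $\mathbb{RL}^B$-filter is a set $F\subseteq A$ with $1\in F$, upward closed, closed under $\cdot$, and such that $a\in F$ implies $Ba\in F$. -}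

module Defs where

open import Level using (Level; suc; _⊔_)
open import Relation.Binary.PropositionalEquality using (_≡_)
open import Data.Product using (_×_)
open import Data.Sum using (_⊎_)

record RLB (ℓ : Level) : Set (suc ℓ) where
  infixr 6 _∨_
  infixr 7 _∧_
  infixr 8 _·_
  infixr 5 _⇒_
  infix 4 _≤_
  field
    Carrier : Set ℓ
    _∧_ _∨_ _·_ _⇒_ : Carrier → Carrier → Carrier
    𝟎 𝟏 : Carrier
    B : Carrier → Carrier

  _≤_ : Carrier → Carrier → Set ℓ
  a ≤ b = a ∧ b ≡ a

  ¬_ : Carrier → Carrier
  ¬ a = a ⇒ 𝟎

  IsBoolean : Carrier → Set ℓ
  IsBoolean a = a ∨ ¬ a ≡ 𝟏

  field
    ∧-comm : ∀ a b → a ∧ b ≡ b ∧ a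
    ∨-comm : ∀ a b → a ∨ b ≡ b ∨ a
    ∧-assoc : ∀ a b c → (a ∧ b) ∧ c ≡ a ∧ (b ∧ c)
    ∨-assoc : ∀ a b c → (a ∨ b) ∨ c ≡ a ∨ (b ∨ c)
    ∧-absorb-∨ : ∀ a b → a ∧ (a ∨ b) ≡ a
    ∨-absorb-∧ : ∀ a b → a ∨ (a ∧ b) ≡ a
    𝟎-least : ∀ a → 𝟎 ≤ a
    𝟏-greatest : ∀ a → a ≤ 𝟏
    ·-comm : ∀ a b → a · b ≡ b · a
    ·-assoc : ∀ a b c → (a · b) · c ≡ a · (b · c)
    ·-identityˡ : ∀ a → 𝟏 · a ≡ a
    residuation-⇒ : ∀ a b c → a · b ≤ c → a ≤ b ⇒ c
    residuation-⇐ : ∀ a b c → a ≤ b ⇒ c → a · b ≤ c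
    B-deflationary : ∀ a → B a ≤ a
    B-boolean : ∀ a → IsBoolean (B a)
    B-greatest : ∀ a b → b ≤ a → IsBoolean b → b ≤ B a

record IsRLBFilter {ℓ : Level} (A : RLB ℓ) (F : RLB.Carrier A → Set ℓ) : Set ℓ where
  open RLB A
  field
    contains-𝟏 : F 𝟏
    upward-closed : ∀ a b → F a → a ≤ b → F b
    ·-closed : ∀ a b → F a → F b → F (a · b)
    B-closed : ∀ a → F a → F (B a)

interval : {ℓ : Level} (A : RLB ℓ) → RLB.Carrier A → RLB.Carrier A → Set ℓ
interval A a x = RLB._≤_ A a x × RLB._≤_ A x (RLB.𝟏 A)

-- A Boolean element a is idempotent up to order: from 𝟏 = a ∨ ¬ a we get
-- a = (a ∨ ¬ a) · a ≤ a · a ∨ ¬ a · a ≤ a · a ∨ 𝟎 = a · a.  Hence if a ≤ x and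
-- a ≤ y then a ≤ a · a ≤ x · y, so [a, 𝟏] is closed under products; closure
-- under B is the maximality of B x among Boolean elements below x.
module Submission where

open import Defs
open import Level using (Level)
open import Data.Product using (_,_)
open import Relation.Binary.Bundles using (Poset)
open import Relation.Binary.Structures using (IsPreorder; IsPartialOrder)
open import Relation.Binary.PropositionalEquality
  using (_≡_; refl; sym; trans; cong; isEquivalence; module ≡-Reasoning)
import Relation.Binary.Reasoning.PartialOrder as PosetReasoning

module RLBProperties {ℓ : Level} (A : RLB ℓ) where
  open RLB A

  ≤-reflexive : ∀ {x y} → x ≡ y → x ≤ y
  ≤-reflexive {x} refl = trans (cong (x ∧_) (sym (∨-absorb-∧ x x))) (∧-absorb-∨ x (x ∧ x))

  ≤-refl : ∀ {x} → x ≤ x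
  ≤-refl = ≤-reflexive refl

  ≤-trans : ∀ {x y z} → x ≤ y → y ≤ z → x ≤ z
  ≤-trans {x} {y} {z} x≤y y≤z = begin
    x ∧ z        ≡⟨ cong (_∧ z) (sym x≤y) ⟩
    (x ∧ y) ∧ z  ≡⟨ ∧-assoc x y z ⟩
    x ∧ (y ∧ z)  ≡⟨ cong (x ∧_) y≤z ⟩
    x ∧ y        ≡⟨ x≤y ⟩
    x            ∎
    where open ≡-Reasoning

  ≤-isPreorder : IsPreorder _≡_ _≤_
  ≤-isPreorder = record
    { isEquivalence = isEquivalence
    ; reflexive     = ≤-reflexive
    ; trans         = ≤-trans
    }

  ≤-antisym : ∀ {x y} → x ≤ y → y ≤ x → x ≡ y
  ≤-antisym {x} {y} x≤y y≤x = trans (sym x≤y) (trans (∧-comm x y) y≤x)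

  ≤-isPartialOrder : IsPartialOrder _≡_ _≤_
  ≤-isPartialOrder = record { isPreorder = ≤-isPreorder ; antisym = ≤-antisym }

  ≤-poset : Poset ℓ ℓ ℓ
  ≤-poset = record { isPartialOrder = ≤-isPartialOrder }

  module ≤-Reasoning = PosetReasoning ≤-poset

  ≤⇒∨≡ : ∀ {x y} → x ≤ y → x ∨ y ≡ y
  ≤⇒∨≡ {x} {y} x≤y = begin
    x ∨ y        ≡⟨ cong (_∨ y) (sym x≤y) ⟩
    (x ∧ y) ∨ y  ≡⟨ ∨-comm (x ∧ y) y ⟩
    y ∨ (x ∧ y)  ≡⟨ cong (y ∨_) (∧-comm x y) ⟩
    y ∨ (y ∧ x)  ≡⟨ ∨-absorb-∧ y x ⟩
    y            ∎
    where open ≡-Reasoning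

  x≤x∨y : ∀ x y → x ≤ x ∨ y
  x≤x∨y = ∧-absorb-∨

  y≤x∨y : ∀ x y → y ≤ x ∨ y
  y≤x∨y x y = ≤-trans (x≤x∨y y x) (≤-reflexive (∨-comm y x))

  ∨-least : ∀ {x y z} → x ≤ z → y ≤ z → x ∨ y ≤ z
  ∨-least {x} {y} {z} x≤z y≤z =
    trans (cong ((x ∨ y) ∧_) (sym x∨y∨z≡z)) (∧-absorb-∨ (x ∨ y) z)
    where
    x∨y∨z≡z : (x ∨ y) ∨ z ≡ z
    x∨y∨z≡z = trans (∨-assoc x y z) (trans (cong (x ∨_) (≤⇒∨≡ y≤z)) (≤⇒∨≡ x≤z))

  ·-monoˡ-≤ : ∀ z {x y} → x ≤ y → x · z ≤ y · z
  ·-monoˡ-≤ z {x} {y} x≤y =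
    residuation-⇐ x z (y · z) (≤-trans x≤y (residuation-⇒ y z (y · z) ≤-refl))

  ·-monoʳ-≤ : ∀ z {x y} → x ≤ y → z · x ≤ z · y
  ·-monoʳ-≤ z {x} {y} x≤y = begin
    z · x  ≡⟨ ·-comm z x ⟩
    x · z  ≤⟨ ·-monoˡ-≤ z x≤y ⟩
    y · z  ≡⟨ ·-comm y z ⟩
    z · y  ∎
    where open ≤-Reasoning

  ·-mono-≤ : ∀ {x x′ y y′} → x ≤ x′ → y ≤ y′ → x · y ≤ x′ · y′
  ·-mono-≤ {x} {x′} {y} {y′} x≤x′ y≤y′ = ≤-trans (·-monoˡ-≤ y x≤x′) (·-monoʳ-≤ x′ y≤y′)

  ·-distribʳ-∨-≤ : ∀ x y z → (y ∨ z) · x ≤ y · x ∨ z · x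
  ·-distribʳ-∨-≤ x y z = residuation-⇐ (y ∨ z) x (y · x ∨ z · x)
    (∨-least (residuation-⇒ y x _ (x≤x∨y _ _)) (residuation-⇒ z x _ (y≤x∨y _ _)))

  ¬x·x≤𝟎 : ∀ x → ¬ x · x ≤ 𝟎
  ¬x·x≤𝟎 x = residuation-⇐ (¬ x) x 𝟎 ≤-refl

  boolean⇒x≤x·x : ∀ {x} → IsBoolean x → x ≤ x · x
  boolean⇒x≤x·x {x} x∨¬x≡𝟏 = begin
    x                  ≡⟨ sym (·-identityˡ x) ⟩
    𝟏 · x              ≡⟨ cong (_· x) (sym x∨¬x≡𝟏) ⟩
    (x ∨ ¬ x) · x      ≤⟨ ·-distribʳ-∨-≤ x x (¬ x) ⟩
    x · x ∨ ¬ x · x    ≤⟨ ∨-least ≤-refl (≤-trans (¬x·x≤𝟎 x) (𝟎-least (x · x))) ⟩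
    x · x              ∎
    where open ≤-Reasoning

proposition12 : {ℓ : Level} (A : RLB ℓ) (a : RLB.Carrier A) →
                RLB.IsBoolean A a → IsRLBFilter A (interval A a)
proposition12 A a a-boolean = record
  { contains-𝟏    = 𝟏-greatest a , ≤-refl
  ; upward-closed = λ x y (a≤x , _) x≤y → ≤-trans a≤x x≤y , 𝟏-greatest y
  ; ·-closed      = λ x y (a≤x , _) (a≤y , _) →
      ≤-trans (boolean⇒x≤x·x a-boolean) (·-mono-≤ a≤x a≤y) , 𝟏-greatest (x · y)
  ; B-closed      = λ x (a≤x , _) → B-greatest x a a≤x a-boolean , 𝟏-greatest (B x)
  }
  where
  open RLB A
  open RLBProperties A
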